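{- If $h \ge 1$, then $\mu_t(Q_h) = 2\cdot A(h,4)$.
   Context: $Q_h$ is the hypercube with vertex set $\{0,1\}^h$, two strings adjacent iff they differ in exactly one position. For $M \subseteq V(G)$, a $u,v$-path is $M$-free if it contains no vertex of $M\setminus\{u,v\}$; $u,v$ are $M$-visible if there is an $M$-free shortest $u,v$-path. $M$ is a total mutual-visibility set if every $u,v\in V(G)$ are $M$-visible, and $\mu_t(G)$ is the maximum size of such a set. $A(n,d)$ is the maximum size of a set $C \subseteq \{0,1\}^n$ such that any two distinct elements of $C$ differ in at least $d$ positions. -}

module Defs where

open import Data.Bool using (Bool; true; false)
open import Data.Nat using (ℕ; zero; suc; _+_; _≤_; _≥_)
open import Data.Vec using (Vec; []; _∷_)
open import Data.List using (List; []; _∷_; length)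
open import Data.List.Membership.Propositional using (_∈_)
open import Data.List.Relation.Unary.Unique.Propositional using (Unique)
open import Data.List.Relation.Unary.All using (All)
open import Data.Product using (Σ; _×_; ∃)
open import Data.Sum using (_⊎_)
open import Relation.Binary.PropositionalEquality using (_≡_)
open import Relation.Nullary using (¬_)

-- Binary strings of length n (= vertices of the hypercube Q_n).
Word : ℕ → Set
Word n = Vec Bool n

hamming : ∀ {n} → Word n → Word n → ℕ
hamming [] [] = 0
hamming (true ∷ xs) (true ∷ ys) = hamming xs ys
hamming (false ∷ xs) (false ∷ ys) = hamming xs ys
hamming (true ∷ xs) (false ∷ ys) = suc (hamming xs ys)
hamming (false ∷ xs) (true ∷ ys) = suc (hamming xs ys)

Adj : ∀ {h} → Word h → Word h → Set
Adj x y = hamming x y ≡ 1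

data Walk {h : ℕ} : Word h → Word h → Set where
  [] : ∀ {u} → Walk u u
  _∷_ : ∀ {u w v} → Adj u w → Walk w v → Walk u v

len : ∀ {h} {u v : Word h} → Walk u v → ℕ
len [] = 0
len (_ ∷ p) = suc (len p)

verts : ∀ {h} {u v : Word h} → Walk u v → List (Word h)
verts {u = u} [] = u ∷ []
verts {u = u} (_ ∷ p) = u ∷ verts p

-- A shortest u,v-path: a u,v-walk of minimum length (such walks are paths).
Shortest : ∀ {h} {u v : Word h} → Walk u v → Set
Shortest {u = u} {v = v} p = ∀ (q : Walk u v) → len p ≤ len q

-- A set of vertices is a duplicate-free list.
VSet : ℕ → Set
VSet h = List (Word h)

Free : ∀ {h} → VSet h → {u v : Word h} → Walk u v → Set
Free M {u} {v} p = All (λ x → x ∈ M → (x ≡ u) ⊎ (x ≡ v)) (verts p)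

Visible : ∀ {h} → VSet h → Word h → Word h → Set
Visible M u v = Σ (Walk u v) (λ p → Shortest p × Free M p)

TotalMV : ∀ {h} → VSet h → Set
TotalMV M = ∀ u v → Visible M u v

IsMaxSize : ∀ {h} → (VSet h → Set) → ℕ → Set
IsMaxSize {h} P m =
  Σ (VSet h) (λ S → Unique S × P S × length S ≡ m)
  × (∀ (S : VSet h) → Unique S → P S → length S ≤ m)

IsMuT : ℕ → ℕ → Set
IsMuT h m = IsMaxSize {h} TotalMV m

IsCode : ∀ {n} → ℕ → VSet n → Set
IsCode d C = ∀ x y → x ∈ C → y ∈ C → ¬ (x ≡ y) → hamming x y ≥ d

IsA : ℕ → ℕ → ℕ → Set
IsA n d a = IsMaxSize {n} (IsCode d) a

-- M ⊆ V(Q_h) is a total mutual-visibility set iff no two vertices of M are at distance 2.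
-- If 2 ≤ d(u, v), then u has two neighbours closer to v, at distance 2 from each other, so
-- one of them avoids M and a geodesic avoiding M can be grown greedily. If x, y ∈ M are at
-- distance 2, their two common neighbours w₁, w₂ are at distance 2 and have only x and y as
-- common neighbours, so no shortest w₁,w₂-path avoids M. Such an M splits by the parity of
-- the weight into two codes of minimum distance 4, so |M| ≤ 2 A(h, 4); conversely, a code
-- of minimum distance 4 together with its copy with the first bit flipped has no two
-- vertices at distance 2.
module Submission where

open import Defs
open import Data.Nat using (ℕ; zero; suc; _+_; _*_; _≤_; _≥_; z≤n; s≤s; s≤s⁻¹)
open import Data.Nat.Properties
  using ( module ≤-Reasoning; ≤-refl; ≤-reflexive; ≤-antisym; ≤-trans; m≤n+m; +-mono-≤
        ; +-identityʳ; +-suc; suc-injective; 0≢1+n)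
open import Data.Bool using (Bool; true; false; not; _xor_)
import Data.Bool as Bool
open import Data.Bool.Properties
  using (not-injective; not-involutive; not-distribˡ-xor; not-distribʳ-xor; xor-same)
open import Data.Vec using ([]; _∷_)
open import Data.Vec.Properties using (∷-injectiveˡ; ∷-injectiveʳ; ≡-dec)
open import Data.List using (List; []; _∷_; length; _++_; map; filter)
open import Data.List.Properties using (length-++; length-map)
open import Data.List.Membership.Propositional using (_∈_; _∉_)
open import Data.List.Membership.Propositional.Properties using (∈-filter⁻; ∈-++⁻; ∈-map⁻)
open import Data.List.Relation.Unary.All using ([]; _∷_)
import Data.List.Relation.Unary.All as All
open import Data.List.Relation.Unary.Any using (any?)
open import Data.List.Relation.Unary.Unique.Propositional using (Unique)
open import Data.List.Relation.Unary.Unique.Propositional.Properties using (filter⁺; map⁺; ++⁺)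
open import Data.Product using (Σ; _×_; _,_; ∃; ∃₂)
open import Data.Sum using (_⊎_; inj₁; inj₂)
import Data.Sum as Sum
open import Data.Empty using (⊥-elim)
open import Function using (_∘_)
open import Relation.Nullary using (¬_; yes; no; Dec; contradiction)
open import Relation.Binary.PropositionalEquality

private
  variable
    n k : ℕ
    u v x y : Word n

_≟_ : (x y : Word n) → Dec (x ≡ y)
_≟_ = ≡-dec Bool._≟_

hamming-refl : (x : Word n) → hamming x x ≡ 0
hamming-refl [] = refl
hamming-refl (true ∷ x) = hamming-refl x
hamming-refl (false ∷ x) = hamming-refl x

hamming-sym : (x y : Word n) → hamming x y ≡ hamming y x
hamming-sym [] [] = refl
hamming-sym (true ∷ x) (true ∷ y) = hamming-sym x y
hamming-sym (true ∷ x) (false ∷ y) = cong suc (hamming-sym x y)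
hamming-sym (false ∷ x) (true ∷ y) = cong suc (hamming-sym x y)
hamming-sym (false ∷ x) (false ∷ y) = hamming-sym x y

hamming≡0⇒≡ : (x y : Word n) → hamming x y ≡ 0 → x ≡ y
hamming≡0⇒≡ [] [] _ = refl
hamming≡0⇒≡ (true ∷ x) (true ∷ y) d = cong (true ∷_) (hamming≡0⇒≡ x y d)
hamming≡0⇒≡ (false ∷ x) (false ∷ y) d = cong (false ∷_) (hamming≡0⇒≡ x y d)

hamming≡1+n⇒≢ : hamming x y ≡ suc k → x ≢ y
hamming≡1+n⇒≢ {x = x} d refl = 0≢1+n (trans (sym (hamming-refl x)) d)

hamming-adj : (u w v : Word n) → Adj u w → hamming u v ≤ suc (hamming w v)
hamming-adj [] [] [] ()
hamming-adj (true ∷ u) (true ∷ w) (true ∷ v) uw = hamming-adj u w v uw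
hamming-adj (true ∷ u) (true ∷ w) (false ∷ v) uw = s≤s (hamming-adj u w v uw)
hamming-adj (false ∷ u) (false ∷ w) (false ∷ v) uw = hamming-adj u w v uw
hamming-adj (false ∷ u) (false ∷ w) (true ∷ v) uw = s≤s (hamming-adj u w v uw)
hamming-adj (true ∷ u) (false ∷ w) (true ∷ v) uw
  with refl ← hamming≡0⇒≡ u w (suc-injective uw) = m≤n+m _ 2
hamming-adj (true ∷ u) (false ∷ w) (false ∷ v) uw
  with refl ← hamming≡0⇒≡ u w (suc-injective uw) = ≤-refl
hamming-adj (false ∷ u) (true ∷ w) (false ∷ v) uw
  with refl ← hamming≡0⇒≡ u w (suc-injective uw) = m≤n+m _ 2
hamming-adj (false ∷ u) (true ∷ w) (true ∷ v) uw
  with refl ← hamming≡0⇒≡ u w (suc-injective uw) = ≤-refl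

hamming≤len : (p : Walk u v) → hamming u v ≤ len p
hamming≤len {u = u} [] = ≤-reflexive (hamming-refl u)
hamming≤len {u = u} {v} (_∷_ {w = w} uw p) = ≤-trans (hamming-adj u w v uw) (s≤s (hamming≤len p))

StepTowards : Word n → Word n → Word n → Set
StepTowards u v w = Adj u w × suc (hamming w v) ≡ hamming u v

stepTowards : (u v : Word n) → 1 ≤ hamming u v → ∃ (StepTowards u v)
stepTowards [] [] ()
stepTowards (true ∷ u) (true ∷ v) d with w , s ← stepTowards u v d = true ∷ w , s
stepTowards (false ∷ u) (false ∷ v) d with w , s ← stepTowards u v d = false ∷ w , s
stepTowards (true ∷ u) (false ∷ v) _ = false ∷ u , cong suc (hamming-refl u) , refl
stepTowards (false ∷ u) (true ∷ v) _ = true ∷ u , cong suc (hamming-refl u) , refl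

twoStepsTowards : (u v : Word n) → 2 ≤ hamming u v →
  ∃₂ λ w₁ w₂ → StepTowards u v w₁ × StepTowards u v w₂ × hamming w₁ w₂ ≡ 2
twoStepsTowards [] [] ()
twoStepsTowards (true ∷ u) (true ∷ v) d
  with w₁ , w₂ , s₁ , s₂ , d₁₂ ← twoStepsTowards u v d =
  true ∷ w₁ , true ∷ w₂ , s₁ , s₂ , d₁₂
twoStepsTowards (false ∷ u) (false ∷ v) d
  with w₁ , w₂ , s₁ , s₂ , d₁₂ ← twoStepsTowards u v d =
  false ∷ w₁ , false ∷ w₂ , s₁ , s₂ , d₁₂
twoStepsTowards (true ∷ u) (false ∷ v) (s≤s d) with w , uw , wv ← stepTowards u v d =
  false ∷ u , true ∷ w , (cong suc (hamming-refl u) , refl) , (uw , cong suc wv) , cong suc uw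
twoStepsTowards (false ∷ u) (true ∷ v) (s≤s d) with w , uw , wv ← stepTowards u v d =
  true ∷ u , false ∷ w , (cong suc (hamming-refl u) , refl) , (uw , cong suc wv) , cong suc uw

Distance2Free : VSet n → Set
Distance2Free M = ∀ {x y} → x ∈ M → y ∈ M → hamming x y ≢ 2

∷-free : {M : VSet n} {u w v : Word n} (uw : Adj u w) {q : Walk w v} →
         w ∉ M → Free M q → Free M {u} (uw ∷ q)
∷-free {M = M} {u} {w} {v} _ w∉M q-free = (λ _ → inj₁ refl) ∷ All.map skip-w q-free
  where
  skip-w : ∀ {x} → (x ∈ M → x ≡ w ⊎ x ≡ v) → x ∈ M → x ≡ u ⊎ x ≡ v
  skip-w x-ok x∈M with x-ok x∈M
  ... | inj₁ refl = ⊥-elim (w∉M x∈M)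
  ... | inj₂ x≡v = inj₂ x≡v

module _ {M : VSet n} (M-free : Distance2Free M) where

  avoidingStep : (u v : Word n) → 2 ≤ hamming u v → ∃ λ w → w ∉ M × StepTowards u v w
  avoidingStep u v d with w₁ , w₂ , s₁ , s₂ , d₁₂ ← twoStepsTowards u v d
    with any? (w₁ ≟_) M | any? (w₂ ≟_) M
  ... | yes w₁∈M | yes w₂∈M = ⊥-elim (M-free w₁∈M w₂∈M d₁₂)
  ... | no w₁∉M | _ = w₁ , w₁∉M , s₁
  ... | yes _ | no w₂∉M = w₂ , w₂∉M , s₂

  freeGeodesic : ∀ d (u v : Word n) → hamming u v ≡ d → Σ (Walk u v) λ p → len p ≡ d × Free M p
  freeGeodesic zero u v d with refl ← hamming≡0⇒≡ u v d = [] , refl , (λ _ → inj₁ refl) ∷ []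
  freeGeodesic (suc zero) u v d = d ∷ [] , refl , (λ _ → inj₁ refl) ∷ (λ _ → inj₂ refl) ∷ []
  freeGeodesic (suc (suc k)) u v d =
    let w , w∉M , uw , wv = avoidingStep u v (subst (2 ≤_) (sym d) (s≤s (s≤s z≤n)))
        q , len-q , q-free = freeGeodesic (suc k) w v (suc-injective (trans wv d))
    in uw ∷ q , cong suc len-q , ∷-free uw w∉M q-free

  distance2Free⇒totalMV : TotalMV M
  distance2Free⇒totalMV u v with p , len-p , p-free ← freeGeodesic (hamming u v) u v refl =
    p , (λ q → subst (_≤ len q) (sym len-p) (hamming≤len q)) , p-free

CommonNeighbour : Word n → Word n → Word n → Set
CommonNeighbour a b z = Adj a z × Adj z b

commonNeighbour-∷-same : ∀ t {z₀} (a b z : Word n) → hamming a b ≡ 2 →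
  CommonNeighbour (t ∷ a) (t ∷ b) (z₀ ∷ z) → z₀ ≡ t × CommonNeighbour a b z
commonNeighbour-∷-same true {true} _ _ _ _ az,zb = refl , az,zb
commonNeighbour-∷-same false {false} _ _ _ _ az,zb = refl , az,zb
commonNeighbour-∷-same true {false} a b z d (az , zb) =
  ⊥-elim (hamming≡1+n⇒≢ d (trans (hamming≡0⇒≡ a z (suc-injective az))
                                 (hamming≡0⇒≡ z b (suc-injective zb))))
commonNeighbour-∷-same false {true} a b z d (az , zb) =
  ⊥-elim (hamming≡1+n⇒≢ d (trans (hamming≡0⇒≡ a z (suc-injective az))
                                 (hamming≡0⇒≡ z b (suc-injective zb))))

commonNeighbour-∷-differ : ∀ t {z₀} (a b z : Word n) →
  CommonNeighbour (t ∷ a) (not t ∷ b) (z₀ ∷ z) → z₀ ∷ z ≡ t ∷ b ⊎ z₀ ∷ z ≡ not t ∷ a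
commonNeighbour-∷-differ true {true} a b z (_ , zb) =
  inj₁ (cong (true ∷_) (hamming≡0⇒≡ z b (suc-injective zb)))
commonNeighbour-∷-differ false {false} a b z (_ , zb) =
  inj₁ (cong (false ∷_) (hamming≡0⇒≡ z b (suc-injective zb)))
commonNeighbour-∷-differ true {false} a b z (az , _) =
  inj₂ (cong (false ∷_) (sym (hamming≡0⇒≡ a z (suc-injective az))))
commonNeighbour-∷-differ false {true} a b z (az , _) =
  inj₂ (cong (true ∷_) (sym (hamming≡0⇒≡ a z (suc-injective az))))

pigeonhole : ∀ {A : Set} {p q x y z : A} → x ≡ p ⊎ x ≡ q → y ≡ p ⊎ y ≡ q → x ≢ y →
  z ≡ p ⊎ z ≡ q → z ≡ x ⊎ z ≡ y
pigeonhole (inj₁ refl) (inj₁ refl) x≢y _ = ⊥-elim (x≢y refl)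
pigeonhole (inj₂ refl) (inj₂ refl) x≢y _ = ⊥-elim (x≢y refl)
pigeonhole (inj₁ refl) (inj₂ refl) _ z∈pq = z∈pq
pigeonhole (inj₂ refl) (inj₁ refl) _ z∈pq = Sum.swap z∈pq

commonNeighbours-distance2 : (a b x y z : Word n) → hamming a b ≡ 2 →
  CommonNeighbour a b x → CommonNeighbour a b y → x ≢ y → CommonNeighbour a b z → z ≡ x ⊎ z ≡ y
commonNeighbours-distance2 [] [] _ _ _ ()
commonNeighbours-distance2 (true ∷ a) (true ∷ b) (x₀ ∷ x) (y₀ ∷ y) (z₀ ∷ z) d cx cy x≢y cz
  with refl , cx′ ← commonNeighbour-∷-same true {x₀} a b x d cx
     | refl , cy′ ← commonNeighbour-∷-same true {y₀} a b y d cy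
     | refl , cz′ ← commonNeighbour-∷-same true {z₀} a b z d cz
  = Sum.map (cong (true ∷_)) (cong (true ∷_))
      (commonNeighbours-distance2 a b x y z d cx′ cy′ (x≢y ∘ cong (true ∷_)) cz′)
commonNeighbours-distance2 (false ∷ a) (false ∷ b) (x₀ ∷ x) (y₀ ∷ y) (z₀ ∷ z) d cx cy x≢y cz
  with refl , cx′ ← commonNeighbour-∷-same false {x₀} a b x d cx
     | refl , cy′ ← commonNeighbour-∷-same false {y₀} a b y d cy
     | refl , cz′ ← commonNeighbour-∷-same false {z₀} a b z d cz
  = Sum.map (cong (false ∷_)) (cong (false ∷_))
      (commonNeighbours-distance2 a b x y z d cx′ cy′ (x≢y ∘ cong (false ∷_)) cz′)
commonNeighbours-distance2 (true ∷ a) (false ∷ b) (_ ∷ x) (_ ∷ y) (_ ∷ z) _ cx cy x≢y cz =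
  pigeonhole (commonNeighbour-∷-differ true a b x cx) (commonNeighbour-∷-differ true a b y cy) x≢y
             (commonNeighbour-∷-differ true a b z cz)
commonNeighbours-distance2 (false ∷ a) (true ∷ b) (_ ∷ x) (_ ∷ y) (_ ∷ z) _ cx cy x≢y cz =
  pigeonhole (commonNeighbour-∷-differ false a b x cx) (commonNeighbour-∷-differ false a b y cy) x≢y
             (commonNeighbour-∷-differ false a b z cz)

midpoint : {M : VSet n} (p : Walk u v) → len p ≡ 2 → Free M p → ∃ λ z → CommonNeighbour u v z × z ∉ M
midpoint (uz ∷ zv ∷ []) refl (_ ∷ z-ok ∷ _) =
  _ , (uz , zv) , Sum.[ hamming≡1+n⇒≢ uz ∘ sym , hamming≡1+n⇒≢ zv ] ∘ z-ok

commonNeighbours∈⇒¬Visible : {M : VSet n} (a b x y : Word n) → hamming a b ≡ 2 →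
  CommonNeighbour a b x → CommonNeighbour a b y → x ≢ y → x ∈ M → y ∈ M → ¬ Visible M a b
commonNeighbours∈⇒¬Visible a b x y d cx@(ax , xb) cy x≢y x∈M y∈M (p , shortest , p-free)
  with z , cz , z∉M ← midpoint p (≤-antisym (shortest (ax ∷ xb ∷ [])) (subst (_≤ len p) d (hamming≤len p)))
                               p-free
  with commonNeighbours-distance2 a b x y z d cx cy x≢y cz
... | inj₁ refl = z∉M x∈M
... | inj₂ refl = z∉M y∈M

totalMV⇒distance2Free : {M : VSet n} → TotalMV M → Distance2Free M
totalMV⇒distance2Free visible {x} {y} x∈M y∈M d
  with w₁ , w₂ , (xw₁ , w₁y) , (xw₂ , w₂y) , d₁₂ ← twoStepsTowards x y (≤-reflexive (sym d)) =
  commonNeighbours∈⇒¬Visible w₁ w₂ x y d₁₂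
    (trans (hamming-sym w₁ x) xw₁ , xw₂)
    (suc-injective (trans w₁y d) , trans (hamming-sym y w₂) (suc-injective (trans w₂y d)))
    (hamming≡1+n⇒≢ d) x∈M y∈M (visible w₁ w₂)

isOdd : ℕ → Bool
isOdd zero = false
isOdd (suc k) = not (isOdd k)

oddWeight : Word n → Bool
oddWeight [] = false
oddWeight (b ∷ x) = b xor oddWeight x

isOdd-hamming : (x y : Word n) → isOdd (hamming x y) ≡ oddWeight x xor oddWeight y
isOdd-hamming [] [] = refl
isOdd-hamming (false ∷ x) (false ∷ y) = isOdd-hamming x y
isOdd-hamming (true ∷ x) (false ∷ y) =
  trans (cong not (isOdd-hamming x y)) (not-distribˡ-xor (oddWeight x) (oddWeight y))
isOdd-hamming (false ∷ x) (true ∷ y) =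
  trans (cong not (isOdd-hamming x y)) (not-distribʳ-xor (oddWeight x) (oddWeight y))
isOdd-hamming (true ∷ x) (true ∷ y) = begin
  isOdd (hamming x y)      ≡⟨ isOdd-hamming x y ⟩
  p xor q                  ≡⟨ not-involutive (p xor q) ⟨
  not (not (p xor q))      ≡⟨ cong not (not-distribʳ-xor p q) ⟩
  not (p xor not q)        ≡⟨ not-distribˡ-xor p (not q) ⟩
  not p xor not q          ∎
  where
  open ≡-Reasoning
  p q : Bool
  p = oddWeight x
  q = oddWeight y

even∧≢0∧≢2⇒4≤ : isOdd k ≡ false → k ≢ 0 → k ≢ 2 → 4 ≤ k
even∧≢0∧≢2⇒4≤ {zero} _ k≢0 _ = ⊥-elim (k≢0 refl)
even∧≢0∧≢2⇒4≤ {2} _ _ k≢2 = ⊥-elim (k≢2 refl)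
even∧≢0∧≢2⇒4≤ {suc (suc (suc (suc k)))} _ _ _ = s≤s (s≤s (s≤s (s≤s z≤n)))

sameOddWeight⇒4≤hamming : oddWeight x ≡ oddWeight y → x ≢ y → hamming x y ≢ 2 → 4 ≤ hamming x y
sameOddWeight⇒4≤hamming {x = x} {y} same x≢y d≢2 = even∧≢0∧≢2⇒4≤ even (x≢y ∘ hamming≡0⇒≡ x y) d≢2
  where
  even : isOdd (hamming x y) ≡ false
  even = trans (isOdd-hamming x y) (trans (cong (_xor oddWeight y) same) (xor-same (oddWeight y)))

fibre : {A : Set} → (A → Bool) → Bool → List A → List A
fibre f b = filter (λ x → f x Bool.≟ b)

length-fibres : {A : Set} (f : A → Bool) (xs : List A) →
  length (fibre f true xs) + length (fibre f false xs) ≡ length xs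
length-fibres f [] = refl
length-fibres f (x ∷ xs) with f x
... | true = cong suc (length-fibres f xs)
... | false = trans (+-suc _ _) (cong suc (length-fibres f xs))

oddWeight-fibre-isCode : {S : VSet n} → Distance2Free S → ∀ b → IsCode 4 (fibre oddWeight b S)
oddWeight-fibre-isCode {S = S} S-free b x y x∈ y∈ x≢y
  with x∈S , x-odd ← ∈-filter⁻ (λ w → oddWeight w Bool.≟ b) {xs = S} x∈
     | y∈S , y-odd ← ∈-filter⁻ (λ w → oddWeight w Bool.≟ b) {xs = S} y∈
  = sameOddWeight⇒4≤hamming (trans x-odd (sym y-odd)) x≢y (S-free x∈S y∈S)

distance2Free⇒length≤2A : ∀ {a} → IsA n 4 a →
  {S : VSet n} → Unique S → Distance2Free S → length S ≤ 2 * a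
distance2Free⇒length≤2A {a = a} (_ , maximal) {S} S-unique S-free = begin
  length S                                                            ≡⟨ length-fibres oddWeight S ⟨
  length (fibre oddWeight true S) + length (fibre oddWeight false S)  ≤⟨ +-mono-≤ (bound true) (bound false) ⟩
  a + a                                                               ≡⟨ cong (a +_) (+-identityʳ a) ⟨
  2 * a                                                               ∎
  where
  open ≤-Reasoning
  bound : ∀ b → length (fibre oddWeight b S) ≤ a
  bound b = maximal _ (filter⁺ _ S-unique) (oddWeight-fibre-isCode S-free b)

flipHead : Word (suc n) → Word (suc n)
flipHead (b ∷ x) = not b ∷ x

flipHead-injective : {x y : Word (suc n)} → flipHead x ≡ flipHead y → x ≡ y
flipHead-injective {x = _ ∷ _} {_ ∷ _} e = cong₂ _∷_ (not-injective (∷-injectiveˡ e)) (∷-injectiveʳ e)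

hamming-flipHead : (x y : Word (suc n)) → hamming (flipHead x) (flipHead y) ≡ hamming x y
hamming-flipHead (true ∷ x) (true ∷ y) = refl
hamming-flipHead (true ∷ x) (false ∷ y) = refl
hamming-flipHead (false ∷ x) (true ∷ y) = refl
hamming-flipHead (false ∷ x) (false ∷ y) = refl

adj-flipHead : (x : Word (suc n)) → Adj x (flipHead x)
adj-flipHead (true ∷ x) = cong suc (hamming-refl x)
adj-flipHead (false ∷ x) = cong suc (hamming-refl x)

doubled : VSet (suc n) → VSet (suc n)
doubled C = C ++ map flipHead C

length-doubled : (C : VSet (suc n)) → length (doubled C) ≡ 2 * length C
length-doubled C = begin
  length (C ++ map flipHead C)        ≡⟨ length-++ C ⟩
  length C + length (map flipHead C)  ≡⟨ cong (length C +_) (length-map flipHead C) ⟩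
  length C + length C                 ≡⟨ cong (length C +_) (+-identityʳ (length C)) ⟨
  2 * length C                        ∎
  where open ≡-Reasoning

module _ {C : VSet (suc n)} (C-code : IsCode 4 C) where

  code-distance≢2 : x ∈ C → y ∈ C → hamming x y ≢ 2
  code-distance≢2 {x = x} {y} x∈C y∈C d with x ≟ y
  ... | yes refl = hamming≡1+n⇒≢ {x = x} d refl
  ... | no x≢y = contradiction (subst (4 ≤_) d (C-code x y x∈C y∈C x≢y)) λ { (s≤s (s≤s ())) }

  code-flipHead-distance : x ∈ C → y ∈ C → hamming (flipHead x) y ≡ 1 ⊎ 3 ≤ hamming (flipHead x) y
  code-flipHead-distance {x = x} {y} x∈C y∈C with x ≟ y
  ... | yes refl = inj₁ (trans (hamming-sym (flipHead x) x) (adj-flipHead x))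
  ... | no x≢y =
    inj₂ (s≤s⁻¹ (≤-trans (C-code x y x∈C y∈C x≢y) (hamming-adj x (flipHead x) y (adj-flipHead x))))

  code-flipHead-distance≢2 : x ∈ C → y ∈ C → hamming (flipHead x) y ≢ 2
  code-flipHead-distance≢2 x∈C y∈C d with code-flipHead-distance x∈C y∈C
  ... | inj₁ d≡1 = contradiction (trans (sym d) d≡1) λ ()
  ... | inj₂ 3≤d = contradiction (subst (3 ≤_) d 3≤d) λ { (s≤s (s≤s ())) }

  code-flipHead-disjoint : x ∈ C → y ∈ C → flipHead x ≢ y
  code-flipHead-disjoint {x = x} x∈C y∈C refl with code-flipHead-distance x∈C y∈C
  ... | inj₁ d≡1 = contradiction (trans (sym (hamming-refl (flipHead x))) d≡1) λ ()
  ... | inj₂ 3≤d = contradiction (subst (3 ≤_) (hamming-refl (flipHead x)) 3≤d) λ ()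

  doubled-distance2Free : Distance2Free (doubled C)
  doubled-distance2Free {x} {y} x∈ y∈ with ∈-++⁻ C x∈ | ∈-++⁻ C y∈
  ... | inj₁ x∈C | inj₁ y∈C = code-distance≢2 x∈C y∈C
  ... | inj₂ x∈F | inj₁ y∈C with x′ , x′∈C , refl ← ∈-map⁻ flipHead x∈F =
    code-flipHead-distance≢2 x′∈C y∈C
  ... | inj₁ x∈C | inj₂ y∈F with y′ , y′∈C , refl ← ∈-map⁻ flipHead y∈F =
    code-flipHead-distance≢2 y′∈C x∈C ∘ trans (hamming-sym (flipHead y′) x)
  ... | inj₂ x∈F | inj₂ y∈F
    with x′ , x′∈C , refl ← ∈-map⁻ flipHead x∈F | y′ , y′∈C , refl ← ∈-map⁻ flipHead y∈F =
    code-distance≢2 x′∈C y′∈C ∘ trans (sym (hamming-flipHead x′ y′))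

  doubled-unique : Unique C → Unique (doubled C)
  doubled-unique C-unique = ++⁺ C-unique (map⁺ flipHead-injective C-unique) disjoint
    where
    disjoint : ∀ {x} → ¬ (x ∈ C × x ∈ map flipHead C)
    disjoint (x∈C , x∈F) with x′ , x′∈C , x≡ ← ∈-map⁻ flipHead x∈F =
      code-flipHead-disjoint x′∈C x∈C (sym x≡)

theorem3p10 : (h : ℕ) → h ≥ 1 → (a : ℕ) → IsA h 4 a → IsMuT h (2 * a)
theorem3p10 (suc h) _ a A@((C , C-unique , C-code , |C|≡a) , _) =
    ( doubled C
    , doubled-unique C-code C-unique
    , distance2Free⇒totalMV (doubled-distance2Free C-code)
    , trans (length-doubled C) (cong (2 *_) |C|≡a))
  , λ S S-unique S-totalMV → distance2Free⇒length≤2A A S-unique (totalMV⇒distance2Free S-totalMV)
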